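{- Let $0\le i\le\ell-1$ and $1\le k\le g_i$, and let $S=C^i_k$. Then $x(\delta(S))=2$.
   Context: Setting: $n\ge3$, $V=[n]$ with arithmetic mod $n$, $d=\lfloor n/2\rfloor$; a symmetric circulant instance with stripe costs $c_1,\dots,c_d$. $\phi$ is a permutation of $[d]$ with $c_{\phi(1)}\le\dots\le c_{\phi(d)}$; $g_0=n$, $g_i=\gcd(\phi(i),g_{i-1})$; $\ell=\min\{i:g_i=1\}$; standing assumption $g_0>g_1>\dots>g_\ell=1$. The graph is viewed as directed: for each $v$ and each $k\in[d]$ there is a directed edge $(v,v+k)$ of length $k$ (for $k=n/2$ this gives both $(v,v+n/2)$ and $(v+n/2,v)$). The weight vector $x$ assigns to each directed edge of length $\phi(i)$ the weight $(g_{i-1}-g_i)/n$ if $i<\ell$, $g_{\ell-1}/n$ if $i=\ell$, and $0$ if $i>\ell$. $C^i_1,\dots,C^i_{g_i}$ are the vertex sets of the connected components of the graph on $V$ whose edges are all edges of lengths $\phi(1),\dots,\phi(i)$ (the residue classes mod $g_i$). $\delta(S)$ is the set of directed edges with exactly one endpoint in $S$ and $x(F)=\sum_{e\in F}x_e$. -}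

module Defs where

open import Data.Bool using (Bool; true; false; if_then_else_; _xor_)
open import Data.Nat using (ℕ; zero; suc; _∸_; _<_; _<?_; _≟_; pred; NonZero)
open import Data.Nat.DivMod using (_mod_)
open import Data.Nat.GCD using (gcd)
open import Data.Fin using (Fin; toℕ)
import Data.Fin
open import Data.Fin.Permutation using (Permutation′; _⟨$⟩ʳ_; _⟨$⟩ˡ_)
open import Data.Integer using (+_)
open import Data.Rational using (ℚ; 0ℚ; _/_) renaming (_+_ to _+ℚ_)
open import Relation.Nullary using (yes; no)

-- Conventions.
--  * Vertices V = [n] are represented by Fin n (vertex v ↔ residue toℕ v mod n).
--  * Lengths 1..d (d = n / 2 = ⌊n/2⌋) are represented by k : Fin d, meaning length suc (toℕ k).
--  * The permutation φ of [d] is a Permutation′ d; the 1-based index i ∈ [d] corresponds to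
--    j : Fin d with i = suc (toℕ j), and φ(i) = suc (toℕ (φ ⟨$⟩ʳ j)).

phiN : ∀ {d} → Permutation′ d → ℕ → ℕ
phiN φ zero = 0
phiN {d} φ (suc i) with i <? d
... | yes p = suc (toℕ (φ ⟨$⟩ʳ Data.Fin.fromℕ< p))
... | no _  = 0

gseq : ∀ {d} → ℕ → Permutation′ d → ℕ → ℕ
gseq n φ zero    = n
gseq n φ (suc i) = gcd (phiN φ (suc i)) (gseq n φ i)

shift : (n : ℕ) .{{_ : NonZero n}} → Fin n → ℕ → Fin n
shift n v a = (toℕ v + a) mod n
  where open Data.Nat using (_+_)

-- Reach n φ i u v : v is reachable from u in the (undirected) graph on V whose edges
-- are all edges of lengths φ(1), …, φ(i).  (Index j : Fin d stands for 1-based index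
-- suc (toℕ j), so "suc (toℕ j) ≤ i" is "toℕ j < i".)
data Reach (n : ℕ) .{{_ : NonZero n}} {d : ℕ} (φ : Permutation′ d) (i : ℕ) (u : Fin n)
     : Fin n → Set where
  here : Reach n φ i u u
  fwd  : ∀ {w} (j : Fin d) → toℕ j < i → Reach n φ i u w →
         Reach n φ i u (shift n w (suc (toℕ (φ ⟨$⟩ʳ j))))
  bwd  : ∀ {w} (j : Fin d) → toℕ j < i → Reach n φ i u (shift n w (suc (toℕ (φ ⟨$⟩ʳ j)))) →
         Reach n φ i u w

-- weight of (each directed edge of length) φ(i), for 1-based index i, given ℓ
xIdx : ∀ {d} (n : ℕ) .{{_ : NonZero n}} → Permutation′ d → (ℓ : ℕ) → ℕ → ℚ
xIdx n φ ℓ i with i <? ℓ | i ≟ ℓ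
... | yes _ | _     = (+ (gseq n φ (pred i) ∸ gseq n φ i)) / n
... | no _  | yes _ = (+ (gseq n φ (pred i))) / n
... | no _  | no _  = 0ℚ

-- x_e for a directed edge of length k (k : Fin d stands for length suc (toℕ k)):
-- the index i with φ(i) = k is suc (toℕ (φ ⟨$⟩ˡ k)).
xLen : ∀ {d} (n : ℕ) .{{_ : NonZero n}} → Permutation′ d → (ℓ : ℕ) → Fin d → ℚ
xLen n φ ℓ k = xIdx n φ ℓ (suc (toℕ (φ ⟨$⟩ˡ k)))

sumFin : (m : ℕ) → (Fin m → ℚ) → ℚ
sumFin zero    f = 0ℚ
sumFin (suc m) f = f Fin.zero +ℚ sumFin m (λ j → f (Fin.suc j))

-- x(δ(S)): sum of x_e over directed edges e = (v, v+k), v ∈ V, k ∈ [d], with exactly one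
-- endpoint in S.
cutWeight : ∀ {d} (n : ℕ) .{{_ : NonZero n}} → Permutation′ d → (ℓ : ℕ) → (Fin n → Bool) → ℚ
cutWeight {d} n φ ℓ S =
  sumFin n (λ v → sumFin d (λ k →
    if S v xor S (shift n v (suc (toℕ k))) then xLen n φ ℓ k else 0ℚ))

-- Write G = g_i. Moving along edges of lengths φ(1), …, φ(i) preserves residues mod G; conversely
-- these lengths and n are periods of S, hence so is their gcd G (Bézout). So S is the residue class of
-- u mod G and has c = n / G elements. A length φ(j) with j ≤ i is a multiple of G and cuts nothing, and
-- lengths φ(j) with j > ℓ have weight 0. For i < j ≤ ℓ we have G ∤ φ(j), since otherwise
-- g_j = g_{j-1} against the strict decrease; then S and S − φ(j) are disjoint and exactly 2c directed
-- edges of length φ(j) cross S. The weights of these lengths telescope to g_i / n, so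
-- x(δ(S)) = 2c · G / n = 2.

module Submission where

open import Defs
open import Data.Bool using (Bool; true)
open import Data.Nat using (ℕ; suc; _<_; _/_; NonZero)
open import Data.Fin using (Fin)
open import Data.Fin.Permutation using (Permutation′; _⟨$⟩ʳ_)
open import Data.Rational using (ℚ)
open import Function.Bundles using (_⇔_)
open import Relation.Binary.PropositionalEquality using (_≡_; _≢_)

open import Data.Bool using (false; if_then_else_; _xor_)
open import Data.Bool.Properties using (⇔→≡; xor-same; if-eta; if-float; if-cong₂)
open import Data.Empty using (⊥; ⊥-elim)
open import Data.Fin as Fin using (toℕ; fromℕ<)
open import Data.Fin.Permutation using (_⟨$⟩ˡ_; permutation; inverseʳ; flip)
open import Data.Fin.Properties using (toℕ-fromℕ<; toℕ-injective; toℕ<n; fromℕ<-toℕ)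
import Data.Integer as ℤ
import Data.Integer.Properties as ℤP
open import Data.Integer.Tactic.RingSolver using (solve-∀)
open import Data.Nat
  using (zero; _+_; _*_; _∸_; _≤_; _≤′_; ≤′-refl; ≤′-step; z≤n; s≤s; z<s; s<s; pred; _<?_; _≤?_; _≟_;
         ≢-nonZero; ≢-nonZero⁻¹)
open import Data.Nat.DivMod
  using (_%_; m%n<n; m%n≤m; m%n%n≡m%n; m<n⇒m%n≡m; m≡m%n+[m/n]*n; [m+kn]%n≡m%n; %-distribˡ-+;
         %-remove-+ˡ; %-remove-+ʳ; m∣n⇒o%n%m≡o%m)
open import Data.Nat.Divisibility
  using (_∣_; divides; quotient; ∣-refl; ∣-trans; ∣-antisym; _∣0; 0∣⇒≡0; n∣m*n; ∣m+n∣m⇒∣n)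
open import Data.Nat.GCD
  using (gcd; gcd[m,n]∣m; gcd[m,n]∣n; gcd-greatest; gcd-GCD; gcd-identityˡ; module Bézout)
open import Data.Nat.Properties
open import Algebra.Properties.Semiring.Sum +-*-semiring
  using (sum; sum-syntax; sum-cong-≗; sum-replicate-zero; ∑-comm; ∑-permute; ∑-distrib-+; *-distribˡ-sum)
open import Data.Rational as ℚ using (0ℚ; 1ℚ)
import Data.Rational.Properties as ℚP
open import Data.Rational.Unnormalised as ℚᵘ using (mkℚᵘ; *≡*)
import Data.Rational.Unnormalised.Properties as ℚᵘP
open import Function.Base using (_∘_)
open import Function.Bundles using (mk⇔; Equivalence)
open import Relation.Binary.PropositionalEquality
  using (refl; sym; trans; cong; cong₂; subst; module ≡-Reasoning)
open import Relation.Nullary using (¬_; yes; no)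
open import Relation.Nullary.Decidable using (⌊_⌋)

over : (n : ℕ) .{{_ : NonZero n}} → ℕ → ℚ
over n a = (ℤ.+ a) ℚ./ n

over-zero : ∀ n .{{_ : NonZero n}} → over n 0 ≡ 0ℚ
over-zero (suc m) = ℚP.fromℚᵘ-cong {mkℚᵘ (ℤ.+ 0) m} {mkℚᵘ (ℤ.+ 0) 0} (*≡* refl)

over-self : ∀ n .{{_ : NonZero n}} → over n n ≡ 1ℚ
over-self (suc m) = ℚP.fromℚᵘ-cong {mkℚᵘ (ℤ.+ suc m) m} {mkℚᵘ (ℤ.+ 1) 0}
  (*≡* (ℤP.*-comm (ℤ.+ suc m) (ℤ.+ 1)))

over-homo-+ : ∀ n .{{_ : NonZero n}} a b → over n (a + b) ≡ over n a ℚ.+ over n b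
over-homo-+ n@(suc m) a b = ℚP.toℚᵘ-injective (begin
  ℚ.toℚᵘ (over n (a + b))                  ≈⟨ ℚP.toℚᵘ-fromℚᵘ (mkℚᵘ (ℤ.+ (a + b)) m) ⟩
  mkℚᵘ (ℤ.+ (a + b)) m                     ≈⟨ *≡* cross ⟩
  mkℚᵘ (ℤ.+ a) m ℚᵘ.+ mkℚᵘ (ℤ.+ b) m       ≈⟨ ℚᵘP.+-cong (ℚP.toℚᵘ-fromℚᵘ (mkℚᵘ (ℤ.+ a) m))
                                                          (ℚP.toℚᵘ-fromℚᵘ (mkℚᵘ (ℤ.+ b) m)) ⟨
  ℚ.toℚᵘ (over n a) ℚᵘ.+ ℚ.toℚᵘ (over n b) ≈⟨ ℚP.toℚᵘ-homo-+ (over n a) (over n b) ⟨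
  ℚ.toℚᵘ (over n a ℚ.+ over n b)           ∎)
  where
  open ℚᵘP.≃-Reasoning
  distrib : ∀ x y s → (x ℤ.+ y) ℤ.* (s ℤ.* s) ≡ (x ℤ.* s ℤ.+ y ℤ.* s) ℤ.* s
  distrib = solve-∀
  cross : (ℤ.+ (a + b)) ℤ.* (ℤ.+ n ℤ.* ℤ.+ n) ≡ ((ℤ.+ a) ℤ.* ℤ.+ n ℤ.+ (ℤ.+ b) ℤ.* ℤ.+ n) ℤ.* ℤ.+ n
  cross = trans (cong (ℤ._* (ℤ.+ n ℤ.* ℤ.+ n)) (ℤP.pos-+ a b)) (distrib (ℤ.+ a) (ℤ.+ b) (ℤ.+ n))

sumFin-over : ∀ n .{{_ : NonZero n}} m {f : Fin m → ℚ} {h : Fin m → ℕ} →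
              (∀ j → f j ≡ over n (h j)) → sumFin m f ≡ over n (sum h)
sumFin-over n zero    _ = sym (over-zero n)
sumFin-over n (suc m) {f} {h} f≡h/n = trans
  (cong₂ ℚ._+_ (f≡h/n Fin.zero) (sumFin-over n m {f ∘ Fin.suc} {h ∘ Fin.suc} (f≡h/n ∘ Fin.suc)))
  (sym (over-homo-+ n (h Fin.zero) (sum (h ∘ Fin.suc))))

∑-zero : ∀ {m} (f : Fin m → ℕ) → (∀ t → f t ≡ 0) → sum f ≡ 0
∑-zero {m} f f≡0 = trans (sum-cong-≗ {x = f} f≡0) (sum-replicate-zero m)

∑-split : ∀ a b (f : ℕ → ℕ) →
          ∑[ t < a + b ] f (toℕ t) ≡ ∑[ t < a ] f (toℕ t) + ∑[ t < b ] f (a + toℕ t)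
∑-split zero    b f = refl
∑-split (suc a) b f = trans (cong (f 0 +_) (∑-split a b (f ∘ suc))) (sym (+-assoc (f 0) _ _))

∑-periodic : ∀ p q (f : ℕ → ℕ) → (∀ t → f (p + t) ≡ f t) →
             ∑[ t < q * p ] f (toℕ t) ≡ q * ∑[ t < p ] f (toℕ t)
∑-periodic p zero    f _        = refl
∑-periodic p (suc q) f periodic = begin
  ∑[ t < p + q * p ] f (toℕ t)                        ≡⟨ ∑-split p (q * p) f ⟩
  ∑[ t < p ] f (toℕ t) + ∑[ t < q * p ] f (p + toℕ t) ≡⟨ cong (∑[ t < p ] f (toℕ t) +_) shifted ⟩
  ∑[ t < p ] f (toℕ t) + q * ∑[ t < p ] f (toℕ t)     ∎
  where
  open ≡-Reasoning
  shifted : ∑[ t < q * p ] f (p + toℕ t) ≡ q * ∑[ t < p ] f (toℕ t)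
  shifted = trans (sum-cong-≗ {q * p} (periodic ∘ toℕ)) (∑-periodic p q f periodic)

⌊suc≟suc⌋ : ∀ a b → ⌊ suc a ≟ suc b ⌋ ≡ ⌊ a ≟ b ⌋
⌊suc≟suc⌋ a b with suc a ≟ suc b | a ≟ b
... | yes _     | yes _   = refl
... | no _      | no _    = refl
... | yes sa≡sb | no a≢b  = ⊥-elim (a≢b (suc-injective sa≡sb))
... | no sa≢sb  | yes a≡b = ⊥-elim (sa≢sb (cong suc a≡b))

∑-indicator : ∀ m r w → r < m → ∑[ t < m ] (if ⌊ toℕ t ≟ r ⌋ then w else 0) ≡ w
∑-indicator (suc m) zero    w _         = trans (cong (w +_) (∑-zero {m} _ (λ _ → refl))) (+-identityʳ w)
∑-indicator (suc m) (suc r) w (s<s r<m) = trans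
  (sum-cong-≗ {m} (λ t → cong (λ b → if b then w else 0) (⌊suc≟suc⌋ (toℕ t) r)))
  (∑-indicator m r w r<m)

∑-telescope : ∀ m (h f : ℕ → ℕ) → (∀ t → t < m → h (suc t) ≤ h t) →
              (∀ t → t < m → f t ≡ h t ∸ h (suc t)) → f m ≡ h m → ∑[ t < suc m ] f (toℕ t) ≡ h 0
∑-telescope zero    h f _        _    last = trans (+-identityʳ (f 0)) last
∑-telescope (suc m) h f antitone step last = begin
  f 0 + ∑[ t < suc m ] f (suc (toℕ t)) ≡⟨ cong₂ _+_ (step 0 z<s) rest ⟩
  h 0 ∸ h 1 + h 1                      ≡⟨ m∸n+n≡m (antitone 0 z<s) ⟩
  h 0                                  ∎
  where
  open ≡-Reasoning
  rest : ∑[ t < suc m ] f (suc (toℕ t)) ≡ h 1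
  rest = ∑-telescope m (h ∘ suc) (f ∘ suc)
    (λ t t<m → antitone (suc t) (s<s t<m)) (λ t t<m → step (suc t) (s<s t<m)) last

[m%n+o]%n≡[m+o]%n : ∀ m o n .{{_ : NonZero n}} → (m % n + o) % n ≡ (m + o) % n
[m%n+o]%n≡[m+o]%n m o n = begin
  (m % n + o) % n         ≡⟨ %-distribˡ-+ (m % n) o n ⟩
  (m % n % n + o % n) % n ≡⟨ cong (λ x → (x + o % n) % n) (m%n%n≡m%n m n) ⟩
  (m % n + o % n) % n     ≡⟨ %-distribˡ-+ m o n ⟨
  (m + o) % n             ∎
  where open ≡-Reasoning

[m+n]%d≡m%d⇒d∣n : ∀ m n d .{{_ : NonZero d}} → (m + n) % d ≡ m % d → d ∣ n
[m+n]%d≡m%d⇒d∣n m n d eq =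
  ∣m+n∣m⇒∣n (divides ((m + n) / d) (+-cancelˡ-≡ (m % d) _ _ expand)) (n∣m*n (m / d))
  where
  open ≡-Reasoning
  expand : m % d + (m / d * d + n) ≡ m % d + (m + n) / d * d
  expand = begin
    m % d + (m / d * d + n)       ≡⟨ +-assoc (m % d) _ n ⟨
    m % d + m / d * d + n         ≡⟨ cong (_+ n) (m≡m%n+[m/n]*n m d) ⟨
    m + n                         ≡⟨ m≡m%n+[m/n]*n (m + n) d ⟩
    (m + n) % d + (m + n) / d * d ≡⟨ cong (_+ (m + n) / d * d) eq ⟩
    m % d + (m + n) / d * d       ∎

module _ {n : ℕ} .{{_ : NonZero n}} where

  toℕ-shift : ∀ v a → toℕ (shift n v a) ≡ (toℕ v + a) % n
  toℕ-shift v a = toℕ-fromℕ< (m%n<n (toℕ v + a) n)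

  shift-+ : ∀ v a b → shift n (shift n v a) b ≡ shift n v (a + b)
  shift-+ v a b = toℕ-injective (begin
    toℕ (shift n (shift n v a) b) ≡⟨ toℕ-shift (shift n v a) b ⟩
    (toℕ (shift n v a) + b) % n   ≡⟨ cong (λ x → (x + b) % n) (toℕ-shift v a) ⟩
    ((toℕ v + a) % n + b) % n     ≡⟨ [m%n+o]%n≡[m+o]%n (toℕ v + a) b n ⟩
    (toℕ v + a + b) % n           ≡⟨ cong (_% n) (+-assoc (toℕ v) a b) ⟩
    (toℕ v + (a + b)) % n         ≡⟨ toℕ-shift v (a + b) ⟨
    toℕ (shift n v (a + b))       ∎)
    where open ≡-Reasoning

  shift-* : ∀ v k → shift n v (k * n) ≡ v
  shift-* v k = toℕ-injective (trans (toℕ-shift v (k * n))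
    (trans ([m+kn]%n≡m%n (toℕ v) k n) (m<n⇒m%n≡m (toℕ<n v))))

  shiftPermutation : ℕ → Permutation′ n
  shiftPermutation a = permutation (λ v → shift n v a) (λ v → shift n v b)
    (λ v → cancel v b a (trans (+-comm b a) a+b≡a*n)) (λ v → cancel v a b a+b≡a*n)
    where
    b = pred n * a
    a+b≡a*n : a + b ≡ a * n
    a+b≡a*n = trans (cong (_* a) (suc-pred n)) (*-comm n a)
    cancel : ∀ v x y → x + y ≡ a * n → shift n (shift n v x) y ≡ v
    cancel v x y eq = trans (shift-+ v x y) (trans (cong (shift n v) eq) (shift-* v a))

  shift-residue : ∀ {G} .{{_ : NonZero G}} → G ∣ n → ∀ v a →
                  toℕ (shift n v a) % G ≡ (toℕ v + a) % G
  shift-residue {G} G∣n v a = trans (cong (_% G) (toℕ-shift v a)) (m∣n⇒o%n%m≡o%m G n (toℕ v + a) G∣n)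

  shift-fromResidue : ∀ {G} .{{_ : NonZero G}} ρ v → toℕ ρ ≡ toℕ v % G → shift n ρ (toℕ v / G * G) ≡ v
  shift-fromResidue {G} ρ v ρ≡v%G = toℕ-injective (begin
    toℕ (shift n ρ (toℕ v / G * G)) ≡⟨ toℕ-shift ρ _ ⟩
    (toℕ ρ + toℕ v / G * G) % n     ≡⟨ cong (λ x → (x + toℕ v / G * G) % n) ρ≡v%G ⟩
    (toℕ v % G + toℕ v / G * G) % n ≡⟨ cong (_% n) (m≡m%n+[m/n]*n (toℕ v) G) ⟨
    toℕ v % n                       ≡⟨ m<n⇒m%n≡m (toℕ<n v) ⟩
    toℕ v                           ∎)
    where open ≡-Reasoning

Period : ∀ {n} .{{_ : NonZero n}} {A : Set} → (Fin n → A) → ℕ → Set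
Period {n} f a = ∀ v → f v ≡ f (shift n v a)

module _ {n : ℕ} .{{_ : NonZero n}} {A : Set} {f : Fin n → A} where

  period-zero : Period f 0
  period-zero v = cong f (sym (shift-* v 0))

  period-n : Period f n
  period-n v = cong f (sym (trans (cong (shift n v) (sym (*-identityˡ n))) (shift-* v 1)))

  period-+ : ∀ {a b} → Period f a → Period f b → Period f (a + b)
  period-+ {a} {b} pa pb v = trans (pa v) (trans (pb (shift n v a)) (cong f (shift-+ v a b)))

  period-+-cancelʳ : ∀ {a b} → Period f (a + b) → Period f b → Period f a
  period-+-cancelʳ {a} {b} pab pb v =
    trans (pab v) (trans (cong f (sym (shift-+ v a b))) (sym (pb (shift n v a))))

  period-* : ∀ {a} → Period f a → ∀ k → Period f (k * a)
  period-* pa zero    = period-zero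
  period-* pa (suc k) = period-+ pa (period-* pa k)

  period-gcd : ∀ {a b} → Period f a → Period f b → Period f (gcd a b)
  period-gcd {a} {b} pa pb with Bézout.identity (gcd-GCD a b)
  ... | Bézout.+- x y eq = period-+-cancelʳ (subst (Period f) (sym eq) (period-* pa x)) (period-* pb y)
  ... | Bézout.-+ x y eq = period-+-cancelʳ (subst (Period f) (sym eq) (period-* pb y)) (period-* pa x)

  -- v and w are both reached from the vertex ρ = v mod G by multiples of G.
  period-residue : ∀ {G} .{{_ : NonZero G}} → Period f G → ∀ {v w} → toℕ v % G ≡ toℕ w % G → f v ≡ f w
  period-residue {G} pG {v} {w} v≡w = trans (sym (fromρ v ρ≡v%G)) (fromρ w (trans ρ≡v%G v≡w))
    where
    v%G<n : toℕ v % G < n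
    v%G<n = ≤-<-trans (m%n≤m (toℕ v) G) (toℕ<n v)
    ρ : Fin n
    ρ = fromℕ< v%G<n
    ρ≡v%G : toℕ ρ ≡ toℕ v % G
    ρ≡v%G = toℕ-fromℕ< v%G<n
    fromρ : ∀ x → toℕ ρ ≡ toℕ x % G → f ρ ≡ f x
    fromρ x eq = trans (period-* pG (toℕ x / G) ρ) (cong f (shift-fromResidue ρ x eq))

residueClass : ∀ {n} (G r : ℕ) .{{_ : NonZero G}} → Fin n → Bool
residueClass G r v = ⌊ toℕ v % G ≟ r ⌋

module _ {n : ℕ} .{{_ : NonZero n}} {G : ℕ} .{{_ : NonZero G}} {r : ℕ} where

  residueClass-period : G ∣ n → ∀ {a} → G ∣ a → Period (residueClass {n} G r) a
  residueClass-period G∣n {a} G∣a v = cong (λ x → ⌊ x ≟ r ⌋)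
    (sym (trans (shift-residue G∣n v a) (%-remove-+ʳ (toℕ v) G∣a)))

  residueClass-shift-∣ : G ∣ n → ∀ v a →
    residueClass G r v ≡ true → residueClass G r (shift n v a) ≡ true → G ∣ a
  residueClass-shift-∣ G∣n v a _ _ with toℕ v % G ≟ r | toℕ (shift n v a) % G ≟ r
  ... | yes v≡r | yes v+a≡r =
    [m+n]%d≡m%d⇒d∣n (toℕ v) a G (trans (sym (shift-residue G∣n v a)) (trans v+a≡r (sym v≡r)))

  ∑-residueClass : ∀ {c} → n ≡ c * G → r < G → ∀ w →
                   ∑[ v < n ] (if residueClass G r v then w else 0) ≡ c * w
  ∑-residueClass {c} n≡c*G r<G w = begin
    ∑[ t < n ] f (toℕ t)
      ≡⟨ cong (λ m → ∑[ t < m ] f (toℕ t)) n≡c*G ⟩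
    ∑[ t < c * G ] f (toℕ t)
      ≡⟨ ∑-periodic G c f (λ t → f-cong (%-remove-+ˡ t ∣-refl)) ⟩
    c * ∑[ t < G ] f (toℕ t)
      ≡⟨ cong (c *_) (sum-cong-≗ {G} (f-cong ∘ m<n⇒m%n≡m ∘ toℕ<n)) ⟩
    c * ∑[ t < G ] (if ⌊ toℕ t ≟ r ⌋ then w else 0)
      ≡⟨ cong (c *_) (∑-indicator G r w r<G) ⟩
    c * w ∎
    where
    open ≡-Reasoning
    f : ℕ → ℕ
    f t = if ⌊ t % G ≟ r ⌋ then w else 0
    f-cong : ∀ {s t} → s % G ≡ t → f s ≡ (if ⌊ t ≟ r ⌋ then w else 0)
    f-cong s%G≡t = cong (λ x → if ⌊ x ≟ r ⌋ then w else 0) s%G≡t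

cutByLength : ∀ n .{{_ : NonZero n}} → (Fin n → Bool) → ℕ → ℕ → ℕ
cutByLength n S a w = ∑[ v < n ] (if S v xor S (shift n v a) then w else 0)

if-xor-disjoint : ∀ x y w → (x ≡ true → y ≡ true → ⊥) →
                  (if x xor y then w else 0) ≡ (if x then w else 0) + (if y then w else 0)
if-xor-disjoint true  true  w both = ⊥-elim (both refl refl)
if-xor-disjoint true  false w _    = sym (+-identityʳ w)
if-xor-disjoint false y     w _    = refl

module _ {n : ℕ} .{{_ : NonZero n}} where

  cutByLength-period : ∀ {S : Fin n → Bool} {a} → Period S a → ∀ w → cutByLength n S a w ≡ 0
  cutByLength-period {S} pa w = ∑-zero _ (λ v →
    cong (λ b → if b then w else 0) (trans (cong (S v xor_) (sym (pa v))) (xor-same (S v))))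

  cutByLength-residueClass : ∀ {G c r} .{{_ : NonZero G}} → n ≡ c * G → r < G →
                             ∀ {a} → ¬ G ∣ a → ∀ w → cutByLength n (residueClass G r) a w ≡ (c + c) * w
  cutByLength-residueClass {G} {c} {r} n≡c*G r<G {a} G∤a w = begin
    ∑[ v < n ] (if R v xor R (shift n v a) then w else 0)
      ≡⟨ sum-cong-≗ {n} (λ v → if-xor-disjoint (R v) (R (shift n v a)) w (disjoint v)) ⟩
    ∑[ v < n ] (inR v + inR (shift n v a))
      ≡⟨ ∑-distrib-+ inR (inR ∘ (λ v → shift n v a)) ⟩
    ∑[ v < n ] inR v + ∑[ v < n ] inR (shift n v a)
      ≡⟨ cong (∑[ v < n ] inR v +_) (∑-permute inR (shiftPermutation a)) ⟨
    ∑[ v < n ] inR v + ∑[ v < n ] inR v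
      ≡⟨ cong₂ _+_ (∑-residueClass {c = c} n≡c*G r<G w) (∑-residueClass {c = c} n≡c*G r<G w) ⟩
    c * w + c * w
      ≡⟨ *-distribʳ-+ w c c ⟨
    (c + c) * w ∎
    where
    open ≡-Reasoning
    R : Fin n → Bool
    R = residueClass G r
    inR : Fin n → ℕ
    inR v = if R v then w else 0
    G∣n : G ∣ n
    G∣n = divides c n≡c*G
    disjoint : ∀ v → R v ≡ true → R (shift n v a) ≡ true → ⊥
    disjoint v Rv Rv+a = G∤a (residueClass-shift-∣ G∣n v a Rv Rv+a)

module _ (n : ℕ) {d : ℕ} (φ : Permutation′ d) where

  phiN-toℕ : ∀ (j : Fin d) → phiN φ (suc (toℕ j)) ≡ suc (toℕ (φ ⟨$⟩ʳ j))
  phiN-toℕ j with toℕ j <? d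
  ... | yes j<d = cong (λ x → suc (toℕ (φ ⟨$⟩ʳ x))) (fromℕ<-toℕ j j<d)
  ... | no j≮d  = ⊥-elim (j≮d (toℕ<n j))

  phiN-⟨$⟩ˡ : ∀ k → phiN φ (suc (toℕ (φ ⟨$⟩ˡ k))) ≡ suc (toℕ k)
  phiN-⟨$⟩ˡ k = trans (phiN-toℕ (φ ⟨$⟩ˡ k)) (cong (suc ∘ toℕ) (inverseʳ φ))

  phiN-≥ : ∀ j → d ≤ j → phiN φ (suc j) ≡ 0
  phiN-≥ j d≤j with j <? d
  ... | yes j<d = ⊥-elim (<⇒≱ j<d d≤j)
  ... | no _    = refl

  gseq-∣ : ∀ {a b} → a ≤ b → gseq n φ b ∣ gseq n φ a
  gseq-∣ a≤b = go (≤⇒≤′ a≤b)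
    where
    go : ∀ {a b} → a ≤′ b → gseq n φ b ∣ gseq n φ a
    go ≤′-refl                    = ∣-refl
    go {b = suc b} (≤′-step a≤′b) = ∣-trans (gcd[m,n]∣n (phiN φ (suc b)) (gseq n φ b)) (go a≤′b)

  gseq-∣-phiN : ∀ {j b} → j ≤ b → gseq n φ b ∣ phiN φ j
  gseq-∣-phiN {zero}  _   = _ ∣0
  gseq-∣-phiN {suc j} j≤b = ∣-trans (gseq-∣ j≤b) (gcd[m,n]∣m _ _)

  gseq-∣-n : ∀ j → gseq n φ j ∣ n
  gseq-∣-n j = gseq-∣ {0} {j} z≤n

  gseq-nonZero : .{{_ : NonZero n}} → ∀ j → NonZero (gseq n φ j)
  gseq-nonZero j = ≢-nonZero (λ g≡0 → ≢-nonZero⁻¹ n (0∣⇒≡0 (subst (_∣ n) g≡0 (gseq-∣-n j))))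

  module _ {ℓ : ℕ} (decreasing : ∀ j → j < ℓ → gseq n φ (suc j) < gseq n φ j) where

    -- φ(d + 1) = 0 (out of range), so g_{d+1} = g_d: the sequence cannot still decrease there.
    ℓ≤d : ℓ ≤ d
    ℓ≤d with ℓ ≤? d
    ... | yes ℓ≤d = ℓ≤d
    ... | no ℓ≰d  = ⊥-elim (<-irrefl stable (decreasing d (≰⇒> ℓ≰d)))
      where
      stable : gseq n φ (suc d) ≡ gseq n φ d
      stable = trans (cong (λ x → gcd x (gseq n φ d)) (phiN-≥ d ≤-refl)) (gcd-identityˡ (gseq n φ d))

    gseq-∤-phiN : ∀ {i j} → i < j → j ≤ ℓ → ¬ gseq n φ i ∣ phiN φ j
    gseq-∤-phiN {i} {suc j} (s≤s i≤j) j<ℓ gᵢ∣φⱼ = <-irrefl stable (decreasing j j<ℓ)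
      where
      stable : gseq n φ (suc j) ≡ gseq n φ j
      stable = ∣-antisym (gcd[m,n]∣n (phiN φ (suc j)) (gseq n φ j))
                         (gcd-greatest (∣-trans (gseq-∣ i≤j) gᵢ∣φⱼ) ∣-refl)

module _ (n : ℕ) .{{_ : NonZero n}} {d : ℕ} (φ : Permutation′ d) (ℓ : ℕ) where

  xNum : ℕ → ℕ
  xNum j with j <? ℓ | j ≟ ℓ
  ... | yes _ | _     = gseq n φ (pred j) ∸ gseq n φ j
  ... | no _  | yes _ = gseq n φ (pred j)
  ... | no _  | no _  = 0

  xIdx≡over : ∀ j → xIdx n φ ℓ j ≡ over n (xNum j)
  xIdx≡over j with j <? ℓ | j ≟ ℓ
  ... | yes _ | _     = refl
  ... | no _  | yes _ = refl
  ... | no _  | no _  = sym (over-zero n)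

  xNum-< : ∀ j → j < ℓ → xNum j ≡ gseq n φ (pred j) ∸ gseq n φ j
  xNum-< j j<ℓ with j <? ℓ
  ... | yes _  = refl
  ... | no j≮ℓ = ⊥-elim (j≮ℓ j<ℓ)

  xNum-ℓ : xNum ℓ ≡ gseq n φ (pred ℓ)
  xNum-ℓ with ℓ <? ℓ | ℓ ≟ ℓ
  ... | yes ℓ<ℓ | _      = ⊥-elim (<-irrefl refl ℓ<ℓ)
  ... | no _    | yes _  = refl
  ... | no _    | no ℓ≢ℓ = ⊥-elim (ℓ≢ℓ refl)

  xNum-> : ∀ j → ℓ < j → xNum j ≡ 0
  xNum-> j ℓ<j with j <? ℓ | j ≟ ℓ
  ... | yes j<ℓ | _       = ⊥-elim (<-asym j<ℓ ℓ<j)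
  ... | no _    | yes j≡ℓ = ⊥-elim (<-irrefl (sym j≡ℓ) ℓ<j)
  ... | no _    | no _    = refl

  xNumAbove : ℕ → ℕ → ℕ
  xNumAbove i j with i <? j
  ... | yes _ = xNum j
  ... | no _  = 0

  xNumAbove-≤ : ∀ {i j} → j ≤ i → xNumAbove i j ≡ 0
  xNumAbove-≤ {i} {j} j≤i with i <? j
  ... | yes i<j = ⊥-elim (<⇒≱ i<j j≤i)
  ... | no _    = refl

  xNumAbove-> : ∀ {i j} → i < j → xNumAbove i j ≡ xNum j
  xNumAbove-> {i} {j} i<j with i <? j
  ... | yes _  = refl
  ... | no i≮j = ⊥-elim (i≮j i<j)

  xNumAbove-beyond : ∀ {i j} → ℓ < j → xNumAbove i j ≡ 0
  xNumAbove-beyond {i} {j} ℓ<j with i <? j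
  ... | yes _ = xNum-> j ℓ<j
  ... | no _  = refl

  module _ (decreasing : ∀ j → j < ℓ → gseq n φ (suc j) < gseq n φ j) where

    ∑-xNum : ∀ i m → suc (i + m) ≡ ℓ → ∑[ t < suc m ] xNum (suc (i + toℕ t)) ≡ gseq n φ i
    ∑-xNum i m i+m<ℓ = trans
      (∑-telescope m (λ t → gseq n φ (i + t)) (λ t → xNum (suc (i + t))) antitone step last)
      (cong (gseq n φ) (+-identityʳ i))
      where
      below : ∀ {t} → t < m → suc (i + t) < ℓ
      below t<m = subst (suc (i + _) <_) i+m<ℓ (s<s (+-monoʳ-< i t<m))
      g-suc : ∀ t → gseq n φ (i + suc t) ≡ gseq n φ (suc (i + t))
      g-suc t = cong (gseq n φ) (+-suc i t)
      antitone : ∀ t → t < m → gseq n φ (i + suc t) ≤ gseq n φ (i + t)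
      antitone t t<m = subst (_≤ gseq n φ (i + t)) (sym (g-suc t))
        (<⇒≤ (decreasing (i + t) (<-trans (n<1+n _) (below t<m))))
      step : ∀ t → t < m → xNum (suc (i + t)) ≡ gseq n φ (i + t) ∸ gseq n φ (i + suc t)
      step t t<m = trans (xNum-< (suc (i + t)) (below t<m)) (cong (gseq n φ (i + t) ∸_) (sym (g-suc t)))
      last : xNum (suc (i + m)) ≡ gseq n φ (i + m)
      last = subst (λ j → xNum j ≡ gseq n φ (pred j)) (sym i+m<ℓ) xNum-ℓ

    ∑-xNumAbove : ∀ {i} → i < ℓ → ∑[ t < d ] xNumAbove i (suc (toℕ t)) ≡ gseq n φ i
    ∑-xNumAbove {i} i<ℓ = begin
      ∑[ t < d ] F (toℕ t)
        ≡⟨ cong (λ m → ∑[ t < m ] F (toℕ t)) d≡ ⟩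
      ∑[ t < i + suc m + e ] F (toℕ t)
        ≡⟨ ∑-split (i + suc m) e F ⟩
      ∑[ t < i + suc m ] F (toℕ t) + ∑[ t < e ] F (i + suc m + toℕ t)
        ≡⟨ cong₂ _+_ (∑-split i (suc m) F) (∑-zero {e} _ (xNumAbove-beyond {i} ∘ beyond ∘ toℕ)) ⟩
      ∑[ t < i ] F (toℕ t) + ∑[ t < suc m ] F (i + toℕ t) + 0
        ≡⟨ cong (λ x → x + ∑[ t < suc m ] F (i + toℕ t) + 0) (∑-zero {i} _ (xNumAbove-≤ {i} ∘ toℕ<n)) ⟩
      ∑[ t < suc m ] F (i + toℕ t) + 0
        ≡⟨ +-identityʳ _ ⟩
      ∑[ t < suc m ] F (i + toℕ t)
        ≡⟨ sum-cong-≗ {suc m} (λ t → xNumAbove-> {i} (s≤s (m≤m+n i (toℕ t)))) ⟩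
      ∑[ t < suc m ] xNum (suc (i + toℕ t))
        ≡⟨ ∑-xNum i m (m+[n∸m]≡n i<ℓ) ⟩
      gseq n φ i ∎
      where
      open ≡-Reasoning
      F : ℕ → ℕ
      F t = xNumAbove i (suc t)
      m = ℓ ∸ suc i
      e = d ∸ ℓ
      ℓ≡ : i + suc m ≡ ℓ
      ℓ≡ = trans (+-suc i m) (m+[n∸m]≡n i<ℓ)
      d≡ : d ≡ i + suc m + e
      d≡ = trans (sym (m+[n∸m]≡n (ℓ≤d n φ decreasing))) (cong (_+ e) (sym ℓ≡))
      beyond : ∀ t → ℓ < suc (i + suc m + t)
      beyond t = s≤s (subst (_≤ i + suc m + t) ℓ≡ (m≤m+n (i + suc m) t))

module _ (n : ℕ) .{{_ : NonZero n}} {d : ℕ} (φ : Permutation′ d) (i : ℕ) (u : Fin n) {S : Fin n → Bool}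
         (S⇔Reach : ∀ v → (S v ≡ true) ⇔ Reach n φ i u v) where

  private
    G : ℕ
    G = gseq n φ i
    instance
      G-nonZero : NonZero G
      G-nonZero = gseq-nonZero n φ i

  component-period-edge : ∀ (j : Fin d) → toℕ j < i → Period S (suc (toℕ (φ ⟨$⟩ʳ j)))
  component-period-edge j j<i v = ⇔→≡ (mk⇔
    (λ Sv → Equivalence.from (S⇔Reach _) (fwd j j<i (Equivalence.to (S⇔Reach v) Sv)))
    (λ Sv+φⱼ → Equivalence.from (S⇔Reach v) (bwd j j<i (Equivalence.to (S⇔Reach _) Sv+φⱼ))))

  component-period-phiN : ∀ j → j ≤ i → Period S (phiN φ j)
  component-period-phiN zero    _   = period-zero
  component-period-phiN (suc j) j<i with j <? d
  ... | yes j<d = component-period-edge (fromℕ< j<d) (subst (_< i) (sym (toℕ-fromℕ< j<d)) j<i)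
  ... | no _    = period-zero

  component-period-gseq : ∀ j → j ≤ i → Period S (gseq n φ j)
  component-period-gseq zero    _   = period-n
  component-period-gseq (suc j) j<i =
    period-gcd (component-period-phiN (suc j) j<i) (component-period-gseq j (<⇒≤ j<i))

  edge-residue : ∀ w (j : Fin d) → toℕ j < i → toℕ (shift n w (suc (toℕ (φ ⟨$⟩ʳ j)))) % G ≡ toℕ w % G
  edge-residue w j j<i = trans (shift-residue (gseq-∣-n n φ i) w _)
    (%-remove-+ʳ (toℕ w) (subst (G ∣_) (phiN-toℕ n φ j) (gseq-∣-phiN n φ j<i)))

  reach-residue : ∀ {v} → Reach n φ i u v → toℕ v % G ≡ toℕ u % G
  reach-residue here              = refl
  reach-residue (fwd {w} j j<i r) = trans (edge-residue w j j<i) (reach-residue r)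
  reach-residue {w} (bwd j j<i r) = trans (sym (edge-residue w j j<i)) (reach-residue r)

  component≡residueClass : ∀ v → S v ≡ residueClass G (toℕ u % G) v
  component≡residueClass v with toℕ v % G ≟ toℕ u % G
  ... | yes v≡u =
    trans (period-residue (component-period-gseq i ≤-refl) v≡u) (Equivalence.from (S⇔Reach u) here)
  ... | no v≢u with S v in Sv
  ...   | true  = ⊥-elim (v≢u (reach-residue (Equivalence.to (S⇔Reach v) Sv)))
  ...   | false = refl

-- n · x(δ(S)): every weight is a multiple of 1/n.
cutNumerator : ∀ n .{{_ : NonZero n}} {d} → Permutation′ d → ℕ → (Fin n → Bool) → ℕ
cutNumerator n {d} φ ℓ S = ∑[ v < n ] ∑[ k < d ]
  (if S v xor S (shift n v (suc (toℕ k))) then xNum n φ ℓ (suc (toℕ (φ ⟨$⟩ˡ k))) else 0)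

cutWeight≡over : ∀ n .{{_ : NonZero n}} {d} (φ : Permutation′ d) ℓ S →
                 cutWeight n φ ℓ S ≡ over n (cutNumerator n φ ℓ S)
cutWeight≡over n {d} φ ℓ S =
  sumFin-over n n (λ v → sumFin-over n d (λ k → if-over (S v xor _) (xIdx≡over n φ ℓ _)))
  where
  if-over : ∀ b {q a} → q ≡ over n a → (if b then q else 0ℚ) ≡ over n (if b then a else 0)
  if-over b q≡a = trans (if-cong₂ b q≡a (sym (over-zero n))) (sym (if-float (over n) b))

module _ (n : ℕ) .{{_ : NonZero n}} {d : ℕ} (φ : Permutation′ d) {ℓ : ℕ}
         (decreasing : ∀ j → j < ℓ → gseq n φ (suc j) < gseq n φ j)
         {i : ℕ} (i<ℓ : i < ℓ) (u : Fin n) {S : Fin n → Bool}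
         (S⇔Reach : ∀ v → (S v ≡ true) ⇔ Reach n φ i u v) where

  private
    G : ℕ
    G = gseq n φ i
    instance
      G-nonZero : NonZero G
      G-nonZero = gseq-nonZero n φ i
    c : ℕ
    c = quotient (gseq-∣-n n φ i)
    n≡c*G : n ≡ c * G
    n≡c*G = _∣_.equality (gseq-∣-n n φ i)
    R : Fin n → Bool
    R = residueClass G (toℕ u % G)

  cutByLength-component : ∀ k →
    cutByLength n R (suc (toℕ k)) (xNum n φ ℓ (suc (toℕ (φ ⟨$⟩ˡ k))))
      ≡ (c + c) * xNumAbove n φ ℓ i (suc (toℕ (φ ⟨$⟩ˡ k)))
  cutByLength-component k with i <? suc (toℕ (φ ⟨$⟩ˡ k))
  cutByLength-component k | no i≮j =
    trans (cutByLength-period (residueClass-period (gseq-∣-n n φ i) G∣L) _) (sym (*-zeroʳ (c + c)))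
    where
    G∣L : G ∣ suc (toℕ k)
    G∣L = subst (G ∣_) (phiN-⟨$⟩ˡ n φ k) (gseq-∣-phiN n φ (≮⇒≥ i≮j))
  cutByLength-component k | yes i<j with suc (toℕ (φ ⟨$⟩ˡ k)) ≤? ℓ
  ... | yes j≤ℓ = cutByLength-residueClass {c = c} n≡c*G (m%n<n (toℕ u) G) G∤L _
    where
    G∤L : ¬ G ∣ suc (toℕ k)
    G∤L G∣L = gseq-∤-phiN n φ decreasing i<j j≤ℓ (subst (G ∣_) (sym (phiN-⟨$⟩ˡ n φ k)) G∣L)
  ... | no j≰ℓ = begin
    cutByLength n R (suc (toℕ k)) (xNum n φ ℓ j) ≡⟨ cong (cutByLength n R (suc (toℕ k))) xⱼ≡0 ⟩
    cutByLength n R (suc (toℕ k)) 0              ≡⟨ ∑-zero {n} _ (λ v → if-eta _) ⟩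
    0                                            ≡⟨ *-zeroʳ (c + c) ⟨
    (c + c) * 0                                  ≡⟨ cong ((c + c) *_) xⱼ≡0 ⟨
    (c + c) * xNum n φ ℓ j                       ∎
    where
    open ≡-Reasoning
    j = suc (toℕ (φ ⟨$⟩ˡ k))
    xⱼ≡0 : xNum n φ ℓ j ≡ 0
    xⱼ≡0 = xNum-> n φ ℓ j (≰⇒> j≰ℓ)

  cutNumerator-component : cutNumerator n φ ℓ S ≡ n + n
  cutNumerator-component = begin
    ∑[ v < n ] ∑[ k < d ] cut S v k
      ≡⟨ sum-cong-≗ {n} (λ v → sum-cong-≗ {d} (λ k → cong₂ (λ x y → if x xor y then w k else 0)
           (component≡residueClass n φ i u S⇔Reach v) (component≡residueClass n φ i u S⇔Reach _))) ⟩
    ∑[ v < n ] ∑[ k < d ] cut R v k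
      ≡⟨ ∑-comm (cut R) ⟩
    ∑[ k < d ] cutByLength n R (suc (toℕ k)) (w k)
      ≡⟨ sum-cong-≗ {d} cutByLength-component ⟩
    ∑[ k < d ] ((c + c) * above (φ ⟨$⟩ˡ k))
      ≡⟨ *-distribˡ-sum (c + c) (above ∘ (φ ⟨$⟩ˡ_)) ⟨
    (c + c) * ∑[ k < d ] above (φ ⟨$⟩ˡ k)
      ≡⟨ cong ((c + c) *_) (∑-permute above (flip φ)) ⟨
    (c + c) * ∑[ t < d ] above t
      ≡⟨ cong ((c + c) *_) (∑-xNumAbove n φ ℓ decreasing i<ℓ) ⟩
    (c + c) * G
      ≡⟨ *-distribʳ-+ G c c ⟩
    c * G + c * G
      ≡⟨ cong₂ _+_ n≡c*G n≡c*G ⟨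
    n + n ∎
    where
    open ≡-Reasoning
    w : Fin d → ℕ
    w k = xNum n φ ℓ (suc (toℕ (φ ⟨$⟩ˡ k)))
    cut : (Fin n → Bool) → Fin n → Fin d → ℕ
    cut P v k = if P v xor P (shift n v (suc (toℕ k))) then w k else 0
    above : Fin d → ℕ
    above t = xNumAbove n φ ℓ i (suc (toℕ t))

lemma3 : (n : ℕ) .{{_ : NonZero n}} → 3 Data.Nat.≤ n →
         (c : Fin (n / 2) → ℚ) → (φ : Permutation′ (n / 2)) →
         (∀ (a b : Fin (n / 2)) → a Data.Fin.≤ b → c (φ ⟨$⟩ʳ a) Data.Rational.≤ c (φ ⟨$⟩ʳ b)) →
         (ℓ : ℕ) → gseq n φ ℓ ≡ 1 → (∀ j → j < ℓ → gseq n φ j ≢ 1) →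
         (∀ j → j < ℓ → gseq n φ (suc j) < gseq n φ j) →
         (i : ℕ) → i < ℓ → (u : Fin n) → (S : Fin n → Bool) →
         (∀ v → (S v ≡ true) ⇔ Reach n φ i u v) →
         cutWeight n φ ℓ S ≡ Data.Rational.1ℚ Data.Rational.+ Data.Rational.1ℚ
lemma3 n _ _ φ _ ℓ _ _ decreasing i i<ℓ u S S⇔Reach = begin
  cutWeight n φ ℓ S             ≡⟨ cutWeight≡over n φ ℓ S ⟩
  over n (cutNumerator n φ ℓ S) ≡⟨ cong (over n) (cutNumerator-component n φ decreasing i<ℓ u S⇔Reach) ⟩
  over n (n + n)                ≡⟨ over-homo-+ n n n ⟩
  over n n ℚ.+ over n n         ≡⟨ cong₂ ℚ._+_ (over-self n) (over-self n) ⟩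
  1ℚ ℚ.+ 1ℚ                     ∎
  where open ≡-Reasoning
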